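{- For all integers $g \ge 1$, $n_{g,2} \le n_{g+1,2}$, where $n_{g,2}$ denotes the number of numerical semigroups of genus $g$ with ordinarization number $2$.
   Context: A numerical semigroup is an additive submonoid $S \subseteq \mathbb{N}_0$ with finite complement. The genus $g(S)$ is the number of elements of $\mathbb{N}_0\setminus S$, the Frobenius number $F(S)$ is the largest such element, and the multiplicity $m(S)$ is the smallest nonzero element of $S$. Let $S_g=\{0,g+1,g+2,\ldots\}$. For $S\neq S_g$ of genus $g$, the ordinarization transform $S\cup\{F(S)\}\setminus\{m(S)\}$ is a numerical semigroup of genus $g$; the ordinarization number $r(S)$ is the number of such transforms needed to reach $S_g$ (equivalently, it is known that $r(S)=\#(S\cap\{1,\ldots,g\})$). -}

module Defs where

open import Data.Nat using (ℕ; zero; suc; _+_; _≤_; _<_; _≟_; _≤?_)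
open import Data.Bool using (Bool; true; false; if_then_else_)
open import Data.Fin using (Fin)
open import Data.Product using (Σ; ∃; _×_; _,_)
open import Relation.Binary.PropositionalEquality using (_≡_; _≢_)
open import Relation.Nullary using (¬_; does)

Subsetℕ : Set
Subsetℕ = ℕ → Bool

_≈_ : Subsetℕ → Subsetℕ → Set
S ≈ T = ∀ n → S n ≡ T n

gapsBelow : Subsetℕ → ℕ → ℕ
gapsBelow S zero = zero
gapsBelow S (suc N) with S N
... | true  = gapsBelow S N
... | false = suc (gapsBelow S N)

IsSubmonoid : Subsetℕ → Set
IsSubmonoid S = (S 0 ≡ true) × (∀ a b → S a ≡ true → S b ≡ true → S (a + b) ≡ true)

HasGenus : Subsetℕ → ℕ → Set
HasGenus S g = Σ ℕ λ N → (∀ n → N ≤ n → S n ≡ true) × (gapsBelow S N ≡ g)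

IsNumSemigroupOfGenus : ℕ → Subsetℕ → Set
IsNumSemigroupOfGenus g S = IsSubmonoid S × HasGenus S g

-- The ordinary semigroup S_g = {0, g+1, g+2, …}.
ordinary : ℕ → Subsetℕ
ordinary g zero = true
ordinary g (suc n) = does (g ≤? n)

IsFrobenius : Subsetℕ → ℕ → Set
IsFrobenius S f = (S f ≡ false) × (∀ n → f < n → S n ≡ true)

IsMultiplicity : Subsetℕ → ℕ → Set
IsMultiplicity S m = (0 < m) × (S m ≡ true) × (∀ n → 0 < n → n < m → S n ≡ false)

OrdTransform : Subsetℕ → Subsetℕ → Set
OrdTransform S T =
  Σ ℕ λ f → Σ ℕ λ m → IsFrobenius S f × IsMultiplicity S m ×
    (∀ n → T n ≡ (if does (n ≟ f) then true else (if does (n ≟ m) then false else S n)))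

HasOrdNumber2 : ℕ → Subsetℕ → Set
HasOrdNumber2 g S =
  ¬ (S ≈ ordinary g) ×
  Σ Subsetℕ λ T → OrdTransform S T × ¬ (T ≈ ordinary g) ×
  Σ Subsetℕ λ U → OrdTransform T U × (U ≈ ordinary g)

NS2 : ℕ → Subsetℕ → Set
NS2 g S = IsNumSemigroupOfGenus g S × HasOrdNumber2 g S

-- The class P (taken up to extensional equality) has exactly k elements:
-- an enumeration by Fin k that is injective and surjective modulo ≈.
HasCount : (Subsetℕ → Set) → ℕ → Set
HasCount P k = Σ (Fin k → Subsetℕ) λ v →
  (∀ i → P (v i)) ×
  (∀ i j → v i ≈ v j → i ≡ j) ×
  (∀ S → P S → ∃ λ i → v i ≈ S)

-- A numerical semigroup S of genus g with r(S) = 2 has exactly two nonzero elements m < x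
-- up to g, hence exactly two gaps a < b above g: S = {0, m, x} ∪ ((g, ∞) ∖ {a, b}), and closure
-- under addition becomes a few linear conditions on (m, x, a, b). So it suffices to map such
-- tuples of genus g injectively to tuples of genus g + 1. Shifting m and x by one and the gaps
-- by one or two works in general; the exceptions come from the sums 2m', m' + x', 2x' hitting
-- a gap, and are handled by a case split on how 2m compares with x and g. Injectivity is shown
-- by an explicit left inverse.
module Submission where

open import Defs
open import Data.Nat using (ℕ; zero; suc; pred; _+_; _∸_; _≤_; _<_; _≟_; _≤?_; z≤n; s≤s)
open import Data.Nat.Properties
open import Data.Nat.Tactic.RingSolver using (solve-∀)
open import Data.Bool using (Bool; true; false; if_then_else_)
open import Data.Fin using (Fin)
open import Function using (_∘′_)
open import Data.Fin.Properties using (injective⇒≤)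
open import Data.Product using (∃; _×_; _,_; proj₁; proj₂)
open import Data.Sum using (_⊎_; inj₁; inj₂)
open import Data.Empty using (⊥; ⊥-elim)
open import Relation.Binary.PropositionalEquality
open import Relation.Binary.Definitions using (tri<; tri≈; tri>)
open import Relation.Nullary using (¬_; does; yes; no)
open import Relation.Nullary.Decidable using (dec-true; dec-false; True; False; toWitness; toWitnessFalse)

clash : ∀ {β} → β ≡ true → β ≡ false → ⊥
clash refl ()

distinct : ∀ (S : Subsetℕ) {p q} → S p ≡ true → S q ≡ false → p ≢ q
distinct S Sp Sq refl = clash Sp Sq

≈-sym : ∀ {S T} → S ≈ T → T ≈ S
≈-sym S≈T n = sym (S≈T n)

≈-trans : ∀ {S T U} → S ≈ T → T ≈ U → S ≈ U
≈-trans S≈T T≈U n = trans (S≈T n) (T≈U n)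

update : Subsetℕ → ℕ → Bool → Subsetℕ
update S p v n = if does (n ≟ p) then v else S n

update-≡ : ∀ S p v → update S p v p ≡ v
update-≡ S p v rewrite dec-true (p ≟ p) refl = refl

update-≢ : ∀ S p v {n} → n ≢ p → update S p v n ≡ S n
update-≢ S p v {n} n≢p rewrite dec-false (n ≟ p) n≢p = refl

-- Definitionally the set in the last component of OrdTransform.
transform : Subsetℕ → ℕ → ℕ → Subsetℕ
transform S f m = update (update S m false) f true

ordinary-> : ∀ g {n} → g < n → ordinary g n ≡ true
ordinary-> g {suc n} (s≤s g≤n) = dec-true (g ≤? n) g≤n

ordinary-≤ : ∀ g {n} → 0 < n → n ≤ g → ordinary g n ≡ false
ordinary-≤ g {suc n} _ n<g = dec-false (g ≤? n) (<⇒≱ n<g)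

ordinary-true : ∀ g n → ordinary g n ≡ true → n ≡ 0 ⊎ g < n
ordinary-true g zero _ = inj₁ refl
ordinary-true g (suc n) e with g ≤? n
... | yes g≤n = inj₂ (s≤s g≤n)
... | no g≰n = ⊥-elim (clash e (dec-false (g ≤? n) g≰n))

gapsBelow-cong : ∀ S S' N → (∀ n → n < N → S n ≡ S' n) → gapsBelow S N ≡ gapsBelow S' N
gapsBelow-cong S S' zero _ = refl
gapsBelow-cong S S' (suc N) agree with S N | S' N | agree N ≤-refl
... | true  | .true  | refl = gapsBelow-cong S S' N (λ n n<N → agree n (m<n⇒m<1+n n<N))
... | false | .false | refl = cong suc (gapsBelow-cong S S' N (λ n n<N → agree n (m<n⇒m<1+n n<N)))

gapsBelow-remove : ∀ S S' p N → S p ≡ true → S' p ≡ false → (∀ n → n ≢ p → S n ≡ S' n) → p < N →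
                   gapsBelow S' N ≡ suc (gapsBelow S N)
gapsBelow-remove S S' p (suc N) Sp S'p agree p<1+N with <-cmp p N
... | tri< p<N _ _ with S N | S' N | agree N (>⇒≢ p<N)
...   | true  | .true  | refl = gapsBelow-remove S S' p N Sp S'p agree p<N
...   | false | .false | refl = cong suc (gapsBelow-remove S S' p N Sp S'p agree p<N)
gapsBelow-remove S S' p (suc N) Sp S'p agree _ | tri≈ _ refl _ rewrite Sp | S'p =
  cong suc (gapsBelow-cong S' S p (λ n n<p → sym (agree n (<⇒≢ n<p))))
gapsBelow-remove S S' p (suc N) Sp S'p agree p<1+N | tri> _ _ N<p = ⊥-elim (<⇒≱ p<1+N N<p)

gapsBelow-ordinary-≤ : ∀ g n → n ≤ g → gapsBelow (ordinary g) (suc n) ≡ n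
gapsBelow-ordinary-≤ g zero _ = refl
gapsBelow-ordinary-≤ g (suc n) n<g rewrite ordinary-≤ g {suc n} (s≤s z≤n) n<g =
  cong suc (gapsBelow-ordinary-≤ g n (<⇒≤ n<g))

gapsBelow-ordinary : ∀ g N → g < N → gapsBelow (ordinary g) N ≡ g
gapsBelow-ordinary g (suc N) (s≤s g≤N) with m≤n⇒m<n∨m≡n g≤N
... | inj₂ refl = gapsBelow-ordinary-≤ g g ≤-refl
... | inj₁ g<N rewrite ordinary-> g g<N = gapsBelow-ordinary g N g<N

gapsBelow-update-false : ∀ S p N → S p ≡ true → p < N →
                         gapsBelow (update S p false) N ≡ suc (gapsBelow S N)
gapsBelow-update-false S p N Sp p<N =
  gapsBelow-remove S (update S p false) p N Sp (update-≡ S p false) (λ n n≢p → sym (update-≢ S p false n≢p)) p<N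

gapsBelow-update-true : ∀ S p N → S p ≡ false → p < N →
                        gapsBelow S N ≡ suc (gapsBelow (update S p true) N)
gapsBelow-update-true S p N Sp p<N =
  gapsBelow-remove (update S p true) S p N (update-≡ S p true) Sp (λ n → update-≢ S p true) p<N

shape : ℕ → ℕ → ℕ → ℕ → ℕ → Subsetℕ
shape g m x a b = update (update (update (update (ordinary g) b false) a false) x true) m true

record ShapeOrder (g m x a b : ℕ) : Set where
  field
    0<m : 0 < m
    m<x : m < x
    x≤g : x ≤ g
    g<a : g < a
    a<b : a < b

data Member (g m x a b n : ℕ) : Set where
  at-0 : n ≡ 0 → Member g m x a b n
  at-m : n ≡ m → Member g m x a b n
  at-x : n ≡ x → Member g m x a b n
  above : g < n → n ≢ a → n ≢ b → Member g m x a b n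

module Shape {g m x a b : ℕ} (o : ShapeOrder g m x a b) where
  open ShapeOrder o public

  S₁ S₂ S₃ S : Subsetℕ
  S₁ = update (ordinary g) b false
  S₂ = update S₁ a false
  S₃ = update S₂ x true
  S = update S₃ m true

  0<x : 0 < x
  0<x = <-trans 0<m m<x

  m<g : m < g
  m<g = <-≤-trans m<x x≤g

  g<b : g < b
  g<b = <-trans g<a a<b

  x<a : x < a
  x<a = ≤-<-trans x≤g g<a

  m<a : m < a
  m<a = <-trans m<x x<a

  x<b : x < b
  x<b = <-trans x<a a<b

  m<b : m < b
  m<b = <-trans m<x x<b

  shape-m : S m ≡ true
  shape-m = update-≡ S₃ m true

  shape-x : S x ≡ true
  shape-x = trans (update-≢ S₃ m true (>⇒≢ m<x)) (update-≡ S₂ x true)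

  shape-a : S a ≡ false
  shape-a = begin
    S a                     ≡⟨ update-≢ S₃ m true (>⇒≢ m<a) ⟩
    S₃ a                    ≡⟨ update-≢ S₂ x true (>⇒≢ x<a) ⟩
    S₂ a                    ≡⟨ update-≡ S₁ a false ⟩
    false                   ∎
    where open ≡-Reasoning

  shape-b : S b ≡ false
  shape-b = begin
    S b                     ≡⟨ update-≢ S₃ m true (>⇒≢ m<b) ⟩
    S₃ b                    ≡⟨ update-≢ S₂ x true (>⇒≢ x<b) ⟩
    S₂ b                    ≡⟨ update-≢ S₁ a false (>⇒≢ a<b) ⟩
    S₁ b                    ≡⟨ update-≡ (ordinary g) b false ⟩
    false                   ∎
    where open ≡-Reasoning

  shape-other : ∀ n → n ≢ m → n ≢ x → n ≢ a → n ≢ b → S n ≡ ordinary g n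
  shape-other n n≢m n≢x n≢a n≢b =
    trans (update-≢ S₃ m true n≢m) (trans (update-≢ S₂ x true n≢x)
      (trans (update-≢ S₁ a false n≢a) (update-≢ (ordinary g) b false n≢b)))

  shape-0 : S 0 ≡ true
  shape-0 = shape-other 0 (<⇒≢ 0<m) (<⇒≢ 0<x) (<⇒≢ (≤-<-trans z≤n g<a)) (<⇒≢ (≤-<-trans z≤n g<b))

  shape-≤ : ∀ n → 0 < n → n ≤ g → n ≢ m → n ≢ x → S n ≡ false
  shape-≤ n 0<n n≤g n≢m n≢x =
    trans (shape-other n n≢m n≢x (<⇒≢ (≤-<-trans n≤g g<a)) (<⇒≢ (≤-<-trans n≤g g<b))) (ordinary-≤ g 0<n n≤g)

  shape-> : ∀ n → g < n → n ≢ a → n ≢ b → S n ≡ true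
  shape-> n g<n n≢a n≢b =
    trans (shape-other n (>⇒≢ (<-trans m<g g<n)) (>⇒≢ (≤-<-trans x≤g g<n)) n≢a n≢b) (ordinary-> g g<n)

  member : ∀ {n} → S n ≡ true → Member g m x a b n
  member {n} Sn with n ≟ m | n ≟ x | n ≟ a | n ≟ b
  ... | yes n≡m | _ | _ | _ = at-m n≡m
  ... | no _ | yes n≡x | _ | _ = at-x n≡x
  ... | no _ | no _ | yes refl | _ = ⊥-elim (clash Sn shape-a)
  ... | no _ | no _ | no _ | yes refl = ⊥-elim (clash Sn shape-b)
  ... | no n≢m | no n≢x | no n≢a | no n≢b with ordinary-true g n (trans (sym (shape-other n n≢m n≢x n≢a n≢b)) Sn)
  ...   | inj₁ n≡0 = at-0 n≡0
  ...   | inj₂ g<n = above g<n n≢a n≢b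

  genus : HasGenus S g
  genus = suc b , above-b , count
    where
    above-b : ∀ n → suc b ≤ n → S n ≡ true
    above-b n b<n = shape-> n (<-trans g<b b<n) (>⇒≢ (<-trans a<b b<n)) (>⇒≢ b<n)
    N : ℕ
    N = suc b
    removed-b : gapsBelow S₁ N ≡ suc g
    removed-b = trans (gapsBelow-update-false (ordinary g) b N (ordinary-> g g<b) ≤-refl)
                      (cong suc (gapsBelow-ordinary g N (m<n⇒m<1+n g<b)))
    removed-a : gapsBelow S₂ N ≡ suc (suc g)
    removed-a = trans (gapsBelow-update-false S₁ a N (trans (update-≢ (ordinary g) b false (<⇒≢ a<b)) (ordinary-> g g<a))
                        (m<n⇒m<1+n a<b))
                      (cong suc removed-b)
    added-x : gapsBelow S₂ N ≡ suc (gapsBelow S₃ N)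
    added-x = gapsBelow-update-true S₂ x N
                (trans (update-≢ S₁ a false (<⇒≢ x<a)) (trans (update-≢ (ordinary g) b false (<⇒≢ x<b)) (ordinary-≤ g 0<x x≤g)))
                (m<n⇒m<1+n x<b)
    added-m : gapsBelow S₃ N ≡ suc (gapsBelow S N)
    added-m = gapsBelow-update-true S₃ m N
                (trans (update-≢ S₂ x true (<⇒≢ m<x)) (trans (update-≢ S₁ a false (<⇒≢ m<a))
                  (trans (update-≢ (ordinary g) b false (<⇒≢ m<b)) (ordinary-≤ g 0<m (<⇒≤ m<g)))))
                (m<n⇒m<1+n m<b)
    count : gapsBelow S N ≡ g
    count = suc-injective (suc-injective (begin
      suc (suc (gapsBelow S N)) ≡⟨ cong suc (sym added-m) ⟩
      suc (gapsBelow S₃ N)      ≡⟨ sym added-x ⟩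
      gapsBelow S₂ N            ≡⟨ removed-a ⟩
      suc (suc g)               ∎))
      where open ≡-Reasoning

  m-least : ∀ {n} → S n ≡ true → 0 < n → m ≤ n
  m-least {n} Sn 0<n with member {n} Sn
  ... | at-0 refl = ⊥-elim (<-irrefl refl 0<n)
  ... | at-m refl = ≤-refl
  ... | at-x refl = <⇒≤ m<x
  ... | above g<n _ _ = <⇒≤ (<-trans m<g g<n)

  x-least : ∀ {n} → S n ≡ true → 0 < n → n ≢ m → x ≤ n
  x-least {n} Sn 0<n n≢m with member {n} Sn
  ... | at-0 refl = ⊥-elim (<-irrefl refl 0<n)
  ... | at-m n≡m = ⊥-elim (n≢m n≡m)
  ... | at-x refl = ≤-refl
  ... | above g<n _ _ = <⇒≤ (≤-<-trans x≤g g<n)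

  a-least : ∀ {n} → S n ≡ false → g < n → a ≤ n
  a-least {n} Sn g<n with <-cmp n a
  ... | tri< n<a _ _ = ⊥-elim (clash (shape-> n g<n (<⇒≢ n<a) (<⇒≢ (<-trans n<a a<b))) Sn)
  ... | tri≈ _ refl _ = ≤-refl
  ... | tri> _ _ a<n = <⇒≤ a<n

  b-least : ∀ {n} → S n ≡ false → g < n → n ≢ a → b ≤ n
  b-least {n} Sn g<n n≢a with <-cmp n b
  ... | tri< n<b _ _ = ⊥-elim (clash (shape-> n g<n n≢a (<⇒≢ n<b)) Sn)
  ... | tri≈ _ refl _ = ≤-refl
  ... | tri> _ _ b<n = <⇒≤ b<n

transform-f : ∀ S f m → transform S f m f ≡ true
transform-f S f m = update-≡ (update S m false) f true

transform-m : ∀ S f m → m ≢ f → transform S f m m ≡ false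
transform-m S f m m≢f = trans (update-≢ (update S m false) f true m≢f) (update-≡ S m false)

transform-other : ∀ S f m {n} → n ≢ f → n ≢ m → transform S f m n ≡ S n
transform-other S f m n≢f n≢m = trans (update-≢ (update S m false) f true n≢f) (update-≢ S m false n≢m)

-- Closure of the shape under addition: 2m, m + x and 2x avoid the gaps, and no gap
-- exceeds an element of {m, x} by more than g, unless it is reached as b = a + m.
record Admissible (g m x a b : ℕ) : Set where
  field
    order : ShapeOrder g m x a b
    2m-ok : x ≡ m + m ⊎ g < m + m
    g<m+x : g < m + x
    a≢2m : a ≢ m + m
    b≢2m : b ≢ m + m
    a≢m+x : a ≢ m + x
    b≢m+x : b ≢ m + x
    a≢2x : a ≢ x + x
    b≢2x : b ≢ x + x
    a≤g+m : a ≤ g + m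
    b-bound : b ≤ g + m ⊎ (b ≡ a + m × b ≤ g + x)

+-above-≢ : ∀ {g s q t} → g < q → t ≤ g + s → s + q ≢ t
+-above-≢ {g} {s} {q} {t} g<q t≤g+s = >⇒≢ (≤-<-trans t≤g+s (subst (_< s + q) (+-comm s g) (+-monoʳ-< s g<q)))

module Admissible⇒NS2 {g m x a b : ℕ} (adm : Admissible g m x a b) where
  open Admissible adm
  open Shape order

  a≤g+x : a ≤ g + x
  a≤g+x = ≤-trans a≤g+m (+-monoʳ-≤ g (<⇒≤ m<x))

  b≤g+x : b ≤ g + x
  b≤g+x with b-bound
  ... | inj₁ b≤g+m = ≤-trans b≤g+m (+-monoʳ-≤ g (<⇒≤ m<x))
  ... | inj₂ (_ , b≤g+x) = b≤g+x

  g<x+x : g < x + x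
  g<x+x = <-trans g<m+x (+-monoˡ-< x m<x)

  closed-m+m : S (m + m) ≡ true
  closed-m+m with 2m-ok
  ... | inj₁ refl = shape-x
  ... | inj₂ g<2m = shape-> (m + m) g<2m (≢-sym a≢2m) (≢-sym b≢2m)

  closed-m+x : S (m + x) ≡ true
  closed-m+x = shape-> (m + x) g<m+x (≢-sym a≢m+x) (≢-sym b≢m+x)

  closed-x+x : S (x + x) ≡ true
  closed-x+x = shape-> (x + x) g<x+x (≢-sym a≢2x) (≢-sym b≢2x)

  closed-m+q : ∀ {q} → g < q → q ≢ a → S (m + q) ≡ true
  closed-m+q {q} g<q q≢a = shape-> (m + q) (<-≤-trans g<q (m≤n+m q m)) (+-above-≢ g<q a≤g+m) m+q≢b
    where
    m+q≢b : m + q ≢ b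
    m+q≢b with b-bound
    ... | inj₁ b≤g+m = +-above-≢ g<q b≤g+m
    ... | inj₂ (b≡a+m , _) = λ e → q≢a (+-cancelˡ-≡ m q a (trans e (trans b≡a+m (+-comm a m))))

  closed-x+q : ∀ {q} → g < q → S (x + q) ≡ true
  closed-x+q {q} g<q = shape-> (x + q) (<-≤-trans g<q (m≤n+m q x)) (+-above-≢ g<q a≤g+x) (+-above-≢ g<q b≤g+x)

  closed-p+q : ∀ {p q} → g < p → g < q → S (p + q) ≡ true
  closed-p+q {p} {q} g<p g<q = shape-> (p + q) (<-≤-trans g<p (m≤m+n p q)) (>⇒≢ (<-trans a<b b<p+q)) (>⇒≢ b<p+q)
    where
    b<p+q : b < p + q
    b<p+q = ≤-<-trans b≤g+x (+-mono-≤-< (<⇒≤ g<p) (≤-<-trans x≤g g<q))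

  closed-comm : ∀ p q → S (q + p) ≡ true → S (p + q) ≡ true
  closed-comm p q = subst (λ n → S n ≡ true) (+-comm q p)

  closed : ∀ p q → S p ≡ true → S q ≡ true → S (p + q) ≡ true
  closed p q Sp Sq with member {p} Sp | member {q} Sq
  ... | at-0 refl | _ = Sq
  ... | _ | at-0 refl = subst (λ n → S n ≡ true) (sym (+-identityʳ p)) Sp
  ... | at-m refl | at-m refl = closed-m+m
  ... | at-m refl | at-x refl = closed-m+x
  ... | at-m refl | above g<q q≢a _ = closed-m+q g<q q≢a
  ... | at-x refl | at-m refl = closed-comm p q closed-m+x
  ... | at-x refl | at-x refl = closed-x+x
  ... | at-x refl | above g<q _ _ = closed-x+q g<q
  ... | above g<p p≢a _ | at-m refl = closed-comm p q (closed-m+q g<p p≢a)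
  ... | above g<p _ _ | at-x refl = closed-comm p q (closed-x+q g<p)
  ... | above g<p _ _ | above g<q _ _ = closed-p+q g<p g<q

  T U : Subsetℕ
  T = transform S b m
  U = transform T a x

  T-x : T x ≡ true
  T-x = trans (transform-other S b m (<⇒≢ x<b) (>⇒≢ m<x)) shape-x

  frobenius-S : IsFrobenius S b
  frobenius-S = shape-b , λ n b<n → shape-> n (<-trans g<b b<n) (>⇒≢ (<-trans a<b b<n)) (>⇒≢ b<n)

  multiplicity-S : IsMultiplicity S m
  multiplicity-S = 0<m , shape-m ,
    λ n 0<n n<m → shape-≤ n 0<n (<⇒≤ (<-trans n<m m<g)) (<⇒≢ n<m) (<⇒≢ (<-trans n<m m<x))

  frobenius-T : IsFrobenius T a
  frobenius-T = trans (transform-other S b m (<⇒≢ a<b) (>⇒≢ m<a)) shape-a , above-a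
    where
    above-a : ∀ n → a < n → T n ≡ true
    above-a n a<n with n ≟ b
    ... | yes refl = transform-f S b m
    ... | no n≢b = trans (transform-other S b m n≢b (>⇒≢ (<-trans m<a a<n)))
                         (shape-> n (<-trans g<a a<n) (>⇒≢ a<n) n≢b)

  multiplicity-T : IsMultiplicity T x
  multiplicity-T = 0<x , T-x , below-x
    where
    below-x : ∀ n → 0 < n → n < x → T n ≡ false
    below-x n 0<n n<x with n ≟ m
    ... | yes refl = transform-m S b m (<⇒≢ m<b)
    ... | no n≢m = trans (transform-other S b m (<⇒≢ (<-trans n<x x<b)) n≢m)
                         (shape-≤ n 0<n (<⇒≤ (<-≤-trans n<x x≤g)) n≢m (<⇒≢ n<x))

  U≈ordinary : U ≈ ordinary g
  U≈ordinary n with n ≟ a | n ≟ x | n ≟ b | n ≟ m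
  ... | yes refl | _ | _ | _ = trans (transform-f T a x) (sym (ordinary-> g g<a))
  ... | no _ | yes refl | _ | _ = trans (transform-m T a x (<⇒≢ x<a)) (sym (ordinary-≤ g 0<x x≤g))
  ... | no n≢a | no n≢x | yes refl | _ =
    trans (transform-other T a x n≢a n≢x) (trans (transform-f S b m) (sym (ordinary-> g g<b)))
  ... | no n≢a | no n≢x | no _ | yes refl =
    trans (transform-other T a x n≢a n≢x) (trans (transform-m S b m (<⇒≢ m<b)) (sym (ordinary-≤ g 0<m (<⇒≤ m<g))))
  ... | no n≢a | no n≢x | no n≢b | no n≢m =
    trans (transform-other T a x n≢a n≢x) (trans (transform-other S b m n≢b n≢m) (shape-other n n≢m n≢x n≢a n≢b))

  ns2 : NS2 g S
  ns2 = ((shape-0 , closed) , genus) ,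
        (λ S≈ → clash shape-m (trans (S≈ m) (ordinary-≤ g 0<m (<⇒≤ m<g)))) ,
        T , (b , m , frobenius-S , multiplicity-S , (λ _ → refl)) ,
        (λ T≈ → clash T-x (trans (T≈ x) (ordinary-≤ g 0<x x≤g))) ,
        U , (a , x , frobenius-T , multiplicity-T , (λ _ → refl)) , U≈ordinary

+-pos⇒< : ∀ {k s t} → 0 < s → k + s ≡ t → k < t
+-pos⇒< {k} 0<s k+s≡t = subst (k <_) k+s≡t (m<m+n k 0<s)

module Closed⇒Admissible {g m x a b : ℕ} (o : ShapeOrder g m x a b)
    (closed : ∀ p q → shape g m x a b p ≡ true → shape g m x a b q ≡ true → shape g m x a b (p + q) ≡ true) where
  open Shape o

  2m-ok : x ≡ m + m ⊎ g < m + m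
  2m-ok with member {m + m} (closed m m shape-m shape-m)
  ... | at-0 e = ⊥-elim (>⇒≢ (<-≤-trans 0<m (m≤m+n m m)) e)
  ... | at-m e = ⊥-elim (>⇒≢ (m<m+n m 0<m) e)
  ... | at-x e = inj₁ (sym e)
  ... | above g<2m _ _ = inj₂ g<2m

  g<m+x : g < m + x
  g<m+x with member {m + x} (closed m x shape-m shape-x)
  ... | at-0 e = ⊥-elim (>⇒≢ (<-≤-trans 0<m (m≤m+n m x)) e)
  ... | at-m e = ⊥-elim (>⇒≢ (m<m+n m 0<x) e)
  ... | at-x e = ⊥-elim (>⇒≢ (m<n+m x 0<m) e)
  ... | above g<m+x _ _ = g<m+x

  difference-gap : ∀ {s t k} → S s ≡ true → S t ≡ false → k + s ≡ t → g < k → k ≡ a ⊎ k ≡ b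
  difference-gap {s} {t} {k} Ss St k+s≡t g<k with k ≟ a | k ≟ b
  ... | yes k≡a | _ = inj₁ k≡a
  ... | no _ | yes k≡b = inj₂ k≡b
  ... | no k≢a | no k≢b = ⊥-elim (distinct S (closed k s (shape-> k g<k k≢a k≢b) Ss) St k+s≡t)

  above-difference : ∀ {s t} → s ≤ t → ¬ t ≤ g + s → g < t ∸ s
  above-difference {s} {t} s≤t t≰g+s =
    +-cancelʳ-< s g (t ∸ s) (subst (g + s <_) (sym (m∸n+n≡m s≤t)) (≰⇒> t≰g+s))

  within-g : ∀ {s t} → S s ≡ true → S t ≡ false → s ≤ t → (∀ {k} → k + s ≡ t → k < a) → t ≤ g + s
  within-g {s} {t} Ss St s≤t below-a with t ≤? g + s
  ... | yes t≤g+s = t≤g+s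
  ... | no t≰g+s with difference-gap Ss St (m∸n+n≡m s≤t) (above-difference s≤t t≰g+s)
  ...   | inj₁ k≡a = ⊥-elim (<⇒≢ (below-a (m∸n+n≡m s≤t)) k≡a)
  ...   | inj₂ k≡b = ⊥-elim (<⇒≢ (<-trans (below-a (m∸n+n≡m s≤t)) a<b) k≡b)

  b-bound : b ≤ g + m ⊎ (b ≡ a + m × b ≤ g + x)
  b-bound with b ≤? g + m
  ... | yes b≤g+m = inj₁ b≤g+m
  ... | no b≰g+m = inj₂ (b≡a+m , within-g shape-x shape-b (<⇒≤ x<b) below-a)
    where
    k+m≡b : b ∸ m + m ≡ b
    k+m≡b = m∸n+n≡m (<⇒≤ m<b)
    b∸m≡a : b ∸ m ≡ a
    b∸m≡a with difference-gap shape-m shape-b k+m≡b (above-difference (<⇒≤ m<b) b≰g+m)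
    ... | inj₁ k≡a = k≡a
    ... | inj₂ k≡b = ⊥-elim (<⇒≢ (+-pos⇒< 0<m k+m≡b) k≡b)
    b≡a+m : b ≡ a + m
    b≡a+m = trans (sym k+m≡b) (cong (_+ m) b∸m≡a)
    below-a : ∀ {k} → k + x ≡ b → k < a
    below-a {k} k+x≡b =
      +-cancelʳ-< x k a (subst (_< a + x) (sym (trans k+x≡b b≡a+m)) (+-monoʳ-< a m<x))

  admissible : Admissible g m x a b
  admissible = record
    { order = o ; 2m-ok = 2m-ok ; g<m+x = g<m+x
    ; a≢2m = ≢-sym (distinct S 2m∈S shape-a) ; b≢2m = ≢-sym (distinct S 2m∈S shape-b)
    ; a≢m+x = ≢-sym (distinct S m+x∈S shape-a) ; b≢m+x = ≢-sym (distinct S m+x∈S shape-b)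
    ; a≢2x = ≢-sym (distinct S 2x∈S shape-a) ; b≢2x = ≢-sym (distinct S 2x∈S shape-b)
    ; a≤g+m = within-g shape-m shape-a (<⇒≤ m<a) (+-pos⇒< 0<m)
    ; b-bound = b-bound }
    where
    2m∈S : S (m + m) ≡ true
    2m∈S = closed m m shape-m shape-m
    m+x∈S : S (m + x) ≡ true
    m+x∈S = closed m x shape-m shape-x
    2x∈S : S (x + x) ≡ true
    2x∈S = closed x x shape-x shape-x

module NS2⇒Shape {g m x a b : ℕ} {S T U : Subsetℕ}
    (S-0 : S 0 ≡ true) (S≉ordinary : ¬ S ≈ ordinary g)
    (S-b : S b ≡ false) (S->b : ∀ n → b < n → S n ≡ true)
    (0<m : 0 < m) (S-m : S m ≡ true) (S-<m : ∀ n → 0 < n → n < m → S n ≡ false)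
    (T≈ : ∀ n → T n ≡ transform S b m n)
    (T-a : T a ≡ false) (0<x : 0 < x) (T-x : T x ≡ true)
    (U≈ : ∀ n → U n ≡ transform T a x n) (U≈ordinary : U ≈ ordinary g) where

  T-b : T b ≡ true
  T-b = trans (T≈ b) (transform-f S b m)

  T-m : T m ≡ false
  T-m = trans (T≈ m) (transform-m S b m (distinct S S-m S-b))

  T-other : ∀ {n} → n ≢ b → n ≢ m → T n ≡ S n
  T-other n≢b n≢m = trans (T≈ _) (transform-other S b m n≢b n≢m)

  U-a : U a ≡ true
  U-a = trans (U≈ a) (transform-f T a x)

  U-x : U x ≡ false
  U-x = trans (U≈ x) (transform-m T a x (distinct T T-x T-a))

  U-other : ∀ {n} → n ≢ a → n ≢ x → U n ≡ T n
  U-other n≢a n≢x = trans (U≈ _) (transform-other T a x n≢a n≢x)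

  g<a : g < a
  g<a with ordinary-true g a (trans (sym (U≈ordinary a)) U-a)
  ... | inj₂ g<a = g<a
  ... | inj₁ refl = ⊥-elim (clash (trans (T-other (distinct S S-0 S-b) (<⇒≢ 0<m)) S-0) T-a)

  x≤g : x ≤ g
  x≤g with x ≤? g
  ... | yes x≤g = x≤g
  ... | no x≰g = ⊥-elim (clash (trans (U≈ordinary x) (ordinary-> g {x} (≰⇒> x≰g))) U-x)

  -- If x < m, then x ∉ S forces x = b, and S = {0} ∪ (b, ∞) would already be U = S_g.
  m<x : m < x
  m<x with <-cmp m x
  ... | tri< m<x _ _ = m<x
  ... | tri≈ _ m≡x _ = ⊥-elim (distinct T T-x T-m (sym m≡x))
  ... | tri> _ _ x<m with x ≟ b
  ...   | no x≢b = ⊥-elim (clash T-x (trans (T-other x≢b (<⇒≢ x<m)) (S-<m x 0<x x<m)))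
  ...   | yes refl = ⊥-elim (S≉ordinary S≈ordinary)
    where
    a≡m : a ≡ m
    a≡m with a ≟ m
    ... | yes a≡m = a≡m
    ... | no a≢m = ⊥-elim (clash (S->b a (≤-<-trans x≤g g<a)) (trans (sym (T-other (>⇒≢ (≤-<-trans x≤g g<a)) a≢m)) T-a))
    S≈ordinary : S ≈ ordinary g
    S≈ordinary n with n ≟ x | n ≟ m
    ... | yes refl | _ = trans S-b (sym (ordinary-≤ g 0<x x≤g))
    ... | no _ | yes refl = trans S-m (sym (ordinary-> g (subst (g <_) a≡m g<a)))
    ... | no n≢x | no n≢m =
      trans (sym (T-other n≢x n≢m)) (trans (sym (U-other (λ n≡a → n≢m (trans n≡a a≡m)) n≢x)) (U≈ordinary n))

  a<b : a < b
  a<b with <-cmp a b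
  ... | tri< a<b _ _ = a<b
  ... | tri≈ _ a≡b _ = ⊥-elim (distinct T T-b T-a (sym a≡b))
  ... | tri> _ _ b<a = ⊥-elim (clash (S->b a b<a) (trans (sym (T-other (>⇒≢ b<a) (>⇒≢ m<a))) T-a))
    where
    m<a : m < a
    m<a = <-trans m<x (≤-<-trans x≤g g<a)

  order : ShapeOrder g m x a b
  order = record { 0<m = 0<m ; m<x = m<x ; x≤g = x≤g ; g<a = g<a ; a<b = a<b }

  open Shape order using (shape-m; shape-x; shape-a; shape-b; shape-other; m<a; x<a; m<b; x<b)

  S≈shape : S ≈ shape g m x a b
  S≈shape n with n ≟ m | n ≟ x | n ≟ a | n ≟ b
  ... | yes refl | _ | _ | _ = trans S-m (sym shape-m)
  ... | no n≢m | yes refl | _ | _ = trans (sym (T-other (<⇒≢ x<b) n≢m)) (trans T-x (sym shape-x))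
  ... | no n≢m | no _ | yes refl | _ = trans (sym (T-other (<⇒≢ a<b) n≢m)) (trans T-a (sym shape-a))
  ... | no _ | no _ | no _ | yes refl = trans S-b (sym shape-b)
  ... | no n≢m | no n≢x | no n≢a | no n≢b =
    trans (sym (T-other n≢b n≢m)) (trans (sym (U-other n≢a n≢x)) (trans (U≈ordinary n) (sym (shape-other n n≢m n≢x n≢a n≢b))))

record Tuple : Set where
  constructor tuple
  field
    m x a b : ℕ

tuple-≡ : ∀ {m x a b m' x' a' b'} → m ≡ m' → x ≡ x' → a ≡ a' → b ≡ b' → tuple m x a b ≡ tuple m' x' a' b'
tuple-≡ refl refl refl refl = refl

shapeᵗ : ℕ → Tuple → Subsetℕ
shapeᵗ g (tuple m x a b) = shape g m x a b

Admissibleᵗ : ℕ → Tuple → Set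
Admissibleᵗ g (tuple m x a b) = Admissible g m x a b

ns2-shapeᵗ : ∀ g t → Admissibleᵗ g t → NS2 g (shapeᵗ g t)
ns2-shapeᵗ g (tuple m x a b) = Admissible⇒NS2.ns2

record ShapeOf (g : ℕ) (S : Subsetℕ) : Set where
  constructor shape-of
  field
    parameters : Tuple
    admissible : Admissibleᵗ g parameters
    ≈shape : S ≈ shapeᵗ g parameters

decompose : ∀ g S → NS2 g S → ShapeOf g S
decompose g S (((S-0 , S-closed) , _) , S≉ordinary ,
               T , (b , m , (S-b , S->b) , (0<m , S-m , S-<m) , T≈) , _ ,
               U , (a , x , (T-a , _) , (0<x , T-x , _) , U≈) , U≈ordinary) =
  shape-of (tuple m x a b) (Closed⇒Admissible.admissible order shape-closed) S≈shape
  where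
  open NS2⇒Shape S-0 S≉ordinary S-b S->b 0<m S-m S-<m T≈ T-a 0<x T-x U≈ U≈ordinary
  shape-closed : ∀ p q → shape g m x a b p ≡ true → shape g m x a b q ≡ true → shape g m x a b (p + q) ≡ true
  shape-closed p q Sp Sq =
    trans (sym (S≈shape (p + q))) (S-closed p q (trans (S≈shape p) Sp) (trans (S≈shape q) Sq))

shapeᵗ-injective : ∀ g t t' → Admissibleᵗ g t → Admissibleᵗ g t' → shapeᵗ g t ≈ shapeᵗ g t' → t ≡ t'
shapeᵗ-injective g (tuple m x a b) (tuple m' x' a' b') adm adm' S≈S' = tuple-≡ m≡m' x≡x' a≡a' b≡b'
  where
  module L = Shape (Admissible.order adm)
  module L' = Shape (Admissible.order adm')
  m≡m' : m ≡ m'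
  m≡m' = ≤-antisym (L.m-least (trans (S≈S' m') L'.shape-m) L'.0<m)
                   (L'.m-least (trans (sym (S≈S' m)) L.shape-m) L.0<m)
  x≡x' : x ≡ x'
  x≡x' = ≤-antisym (L.x-least (trans (S≈S' x') L'.shape-x) L'.0<x (λ x'≡m → >⇒≢ L'.m<x (trans x'≡m m≡m')))
                   (L'.x-least (trans (sym (S≈S' x)) L.shape-x) L.0<x (λ x≡m' → >⇒≢ L.m<x (trans x≡m' (sym m≡m'))))
  a≡a' : a ≡ a'
  a≡a' = ≤-antisym (L.a-least (trans (S≈S' a') L'.shape-a) L'.g<a)
                   (L'.a-least (trans (sym (S≈S' a)) L.shape-a) L.g<a)
  b≡b' : b ≡ b'
  b≡b' = ≤-antisym (L.b-least (trans (S≈S' b') L'.shape-b) L'.g<b (λ b'≡a → >⇒≢ L'.a<b (trans b'≡a a≡a')))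
                   (L'.b-least (trans (sym (S≈S' b)) L.shape-b) L.g<b (λ b≡a' → >⇒≢ L.a<b (trans b≡a' (sym a≡a'))))

HasCount-≤ : ∀ {P Q : Subsetℕ → Set} {k l} (f : ∀ S → P S → Subsetℕ) →
             (∀ S p → Q (f S p)) → (∀ S S' p p' → f S p ≈ f S' p' → S ≈ S') →
             HasCount P k → HasCount Q l → k ≤ l
HasCount-≤ {k = k} {l} f f-Q f-reflects (v , vP , v-injective , _) (w , _ , _ , w-onto) =
  injective⇒≤ j-injective
  where
  image : Fin k → Subsetℕ
  image i = f (v i) (vP i)
  hit : ∀ i → ∃ λ j → w j ≈ image i
  hit i = w-onto (image i) (f-Q (v i) (vP i))
  j : Fin k → Fin l
  j i = proj₁ (hit i)
  j-injective : ∀ {i i'} → j i ≡ j i' → i ≡ i'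
  j-injective {i} {i'} ji≡ji' = v-injective i i' (f-reflects (v i) (v i') (vP i) (vP i')
    (≈-trans (≈-sym (proj₂ (hit i))) (subst (λ j → w j ≈ image i') (sym ji≡ji') (proj₂ (hit i')))))

≢-+-suc : ∀ {p q r} → p ≢ q + r → suc p ≢ q + suc r
≢-+-suc {p} {q} {r} p≢q+r e = p≢q+r (suc-injective (trans e (+-suc q r)))

≤-+-suc : ∀ {p q r} → p ≤ q + r → suc p ≤ q + suc r
≤-+-suc {p} {q} {r} p≤q+r = subst (suc p ≤_) (sym (+-suc q r)) (s≤s p≤q+r)

+-suc-suc : ∀ p q → suc p + suc q ≡ suc (suc (p + q))
+-suc-suc p q = cong suc (+-suc p q)

-- By 2m-ok an admissible tuple is high (g < 2m), doubled (x = 2m < g) or tight (x = 2m = g);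
-- it is linked when b = a + m, the second alternative of b-bound.
linked : ∀ {g m x a b} → Admissible g m x a b → ¬ b ≤ g + m → b ≡ a + m × b ≤ g + x
linked adm b≰g+m with Admissible.b-bound adm
... | inj₁ b≤g+m = ⊥-elim (b≰g+m b≤g+m)
... | inj₂ b-linked = b-linked

high : ∀ {g m x a b} → Admissible g m x a b → x ≢ m + m → g < m + m
high adm x≢2m with Admissible.2m-ok adm
... | inj₁ x≡2m = ⊥-elim (x≢2m x≡2m)
... | inj₂ g<2m = g<2m

doubled : ∀ {g m a b} → Admissible g m (m + m) a b → g ≢ m + m → m + m < g
doubled adm g≢2m = ≤∧≢⇒< (ShapeOrder.x≤g (Admissible.order adm)) (≢-sym g≢2m)

module ShiftGaps {g m x a b : ℕ} (adm : Admissible g m x a b) (g≤2m : g ≤ m + m) (b≤g+m : b ≤ g + m) where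
  open Admissible adm
  open ShapeOrder order

  admissible : Admissible (suc g) (suc m) (suc x) (suc (suc a)) (suc (suc b))
  admissible = record
    { order = record { 0<m = s≤s z≤n ; m<x = s≤s m<x ; x≤g = s≤s x≤g
                     ; g<a = s≤s (m<n⇒m<1+n g<a) ; a<b = s≤s (s≤s a<b) }
    ; 2m-ok = inj₂ (s≤s (≤-+-suc g≤2m))
    ; g<m+x = s≤s (≤-+-suc (<⇒≤ g<m+x))
    ; a≢2m = ≢-+-suc a≢2m ∘′ suc-injective
    ; b≢2m = ≢-+-suc b≢2m ∘′ suc-injective
    ; a≢m+x = ≢-+-suc a≢m+x ∘′ suc-injective
    ; b≢m+x = ≢-+-suc b≢m+x ∘′ suc-injective
    ; a≢2x = ≢-+-suc a≢2x ∘′ suc-injective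
    ; b≢2x = ≢-+-suc b≢2x ∘′ suc-injective
    ; a≤g+m = s≤s (≤-+-suc a≤g+m)
    ; b-bound = inj₁ (s≤s (≤-+-suc b≤g+m)) }

module HighLinked {g m x a b : ℕ} (adm : Admissible g m x a b) (x≢2m : x ≢ m + m) (b≰g+m : ¬ b ≤ g + m) where
  open Admissible adm
  open Shape order using (0<m; m<x; x≤g; g<a; m<g; m<a; x<a)

  g<2m : g < m + m
  g<2m = high adm x≢2m
  b≡a+m : b ≡ a + m
  b≡a+m = proj₁ (linked adm b≰g+m)
  b≤g+x : b ≤ g + x
  b≤g+x = proj₂ (linked adm b≰g+m)

  a<m+x : a < m + x
  a<m+x = +-cancelʳ-< m a (m + x) (begin-strict
    a + m       ≡⟨ sym b≡a+m ⟩
    b           ≤⟨ b≤g+x ⟩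
    g + x       <⟨ +-monoˡ-< x g<2m ⟩
    m + m + x   ≡⟨ swap m x ⟩
    m + x + m   ∎)
    where
    open ≤-Reasoning
    swap : ∀ m x → m + m + x ≡ m + x + m
    swap = solve-∀

  admissible : a ≢ suc (m + m) → Admissible (suc g) (suc m) (suc x) (suc a) (suc (suc (a + m)))
  admissible a≢2m+1 = record
    { order = record { 0<m = s≤s z≤n ; m<x = s≤s m<x ; x≤g = s≤s x≤g
                     ; g<a = s≤s g<a ; a<b = s≤s (s≤s (m≤m+n a m)) }
    ; 2m-ok = inj₂ (s≤s (≤-+-suc (<⇒≤ g<2m)))
    ; g<m+x = s≤s (≤-+-suc (<⇒≤ g<m+x))
    ; a≢2m = λ e → a≢2m+1 (trans (suc-injective e) (+-suc m m))
    ; b≢2m = λ e → >⇒≢ (+-monoˡ-< m m<a) (suc-injective (trans (suc-injective e) (+-suc m m)))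
    ; a≢m+x = λ e → <⇒≢ (m<n⇒m<1+n a<m+x) (trans (suc-injective e) (+-suc m x))
    ; b≢m+x = λ e → >⇒≢ x<a (+-cancelʳ-≡ m a x (trans (suc-injective (trans (suc-injective e) (+-suc m x))) (+-comm m x)))
    ; a≢2x = λ e → <⇒≢ (m<n⇒m<1+n (<-trans a<m+x (+-monoˡ-< x m<x))) (trans (suc-injective e) (+-suc x x))
    ; b≢2x = λ e → b≢2x (trans b≡a+m (suc-injective (trans (suc-injective e) (+-suc x x))))
    ; a≤g+m = s≤s (≤-trans a≤g+m (+-monoʳ-≤ g (n≤1+n m)))
    ; b-bound = inj₂ (cong suc (sym (+-suc a m)) , s≤s (≤-+-suc (subst (_≤ g + x) b≡a+m b≤g+x))) }

  module _ (a≡2m+1 : a ≡ suc (m + m)) where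
    b≡3m+1 : b ≡ suc (m + m) + m
    b≡3m+1 = trans b≡a+m (cong (_+ m) a≡2m+1)

    admissible-keep : x + x ≢ m + m + m → Admissible (suc g) (suc m) (suc x) a (suc (a + m))
    admissible-keep 2x≢3m rewrite a≡2m+1 = record
      { order = record { 0<m = s≤s z≤n ; m<x = s≤s m<x ; x≤g = s≤s x≤g
                       ; g<a = s≤s g<2m ; a<b = s≤s (m≤m+n (suc (m + m)) m) }
      ; 2m-ok = inj₂ (s≤s (≤-+-suc (<⇒≤ g<2m)))
      ; g<m+x = s≤s (≤-+-suc (<⇒≤ g<m+x))
      ; a≢2m = λ e → <⇒≢ (n<1+n (m + m)) (trans (suc-injective e) (+-suc m m))
      ; b≢2m = λ e → >⇒≢ (m<m+n (m + m) 0<m) (suc-injective (trans (suc-injective e) (+-suc m m)))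
      ; a≢m+x = λ e → <⇒≢ (m<n⇒m<1+n m<x) (+-cancelˡ-≡ m m (suc x) (suc-injective e))
      ; b≢m+x = λ e → <⇒≢ (≤-<-trans x≤g g<2m)
          (sym (+-cancelˡ-≡ m (m + m) x (trans (+-comm m (m + m)) (suc-injective (trans (suc-injective e) (+-suc m x))))))
      ; a≢2x = λ e → <⇒≢ (m<n⇒m<1+n (<-trans (+-monoˡ-< m m<x) (+-monoʳ-< x m<x))) (trans (suc-injective e) (+-suc x x))
      ; b≢2x = λ e → 2x≢3m (sym (suc-injective (trans (suc-injective e) (+-suc x x))))
      ; a≤g+m = s≤s (≤-trans (+-monoˡ-≤ m (<⇒≤ m<g)) (+-monoʳ-≤ g (n≤1+n m)))
      ; b-bound = inj₂ (sym (+-suc (suc (m + m)) m) ,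
                        s≤s (≤-trans (subst (_≤ g + x) b≡3m+1 b≤g+x) (+-monoʳ-≤ g (n≤1+n x)))) }

    admissible-jump : x + x ≡ m + m + m → Admissible (suc g) (suc m) (suc x) (suc (suc g)) (suc (suc (g + m)))
    admissible-jump 2x≡3m = record
      { order = record { 0<m = s≤s z≤n ; m<x = s≤s m<x ; x≤g = s≤s x≤g
                       ; g<a = n<1+n (suc g) ; a<b = s≤s (s≤s (m<m+n g 0<m)) }
      ; 2m-ok = inj₂ (s≤s (≤-+-suc (<⇒≤ g<2m)))
      ; g<m+x = s≤s (≤-+-suc (<⇒≤ g<m+x))
      ; a≢2m = λ e → <⇒≢ g<2m (suc-injective (trans (suc-injective e) (+-suc m m)))
      ; b≢2m = λ e → >⇒≢ m<g (+-cancelʳ-≡ m g m (suc-injective (trans (suc-injective e) (+-suc m m))))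
      ; a≢m+x = λ e → <⇒≢ g<m+x (suc-injective (trans (suc-injective e) (+-suc m x)))
      ; b≢m+x = λ e → g≢x (+-cancelʳ-≡ m g x (trans (suc-injective (trans (suc-injective e) (+-suc m x))) (+-comm m x)))
      ; a≢2x = λ e → <⇒≢ (<-trans g<m+x (+-monoˡ-< x m<x)) (suc-injective (trans (suc-injective e) (+-suc x x)))
      ; b≢2x = λ e → <⇒≢ g<2m (+-cancelʳ-≡ m g (m + m) (trans (suc-injective (trans (suc-injective e) (+-suc x x))) 2x≡3m))
      ; a≤g+m = s≤s (≤-+-suc (m≤m+n g m))
      ; b-bound = inj₁ (s≤s (≤-+-suc ≤-refl)) }
      where
      g≢x : g ≢ x
      g≢x g≡x = <-irrefl refl (begin-strict
        suc (m + m) + m ≡⟨ sym b≡3m+1 ⟩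
        b               ≤⟨ b≤g+x ⟩
        g + x           ≡⟨ cong (_+ x) g≡x ⟩
        x + x           ≡⟨ 2x≡3m ⟩
        m + m + m       <⟨ n<1+n _ ⟩
        suc (m + m) + m ∎)
        where open ≤-Reasoning

triple : ℕ → ℕ
triple m = m + (m + m)

-- v + 1, except that values beyond 3m + 1 move by 2: the image avoids 3m + 3, which is
-- m' + x' for m' = m + 1 and x' = 2m'.
bump : ℕ → ℕ → ℕ
bump m v = if does (v ≤? suc (triple m)) then suc v else suc (suc v)

bump-≤ : ∀ m {v} → v ≤ suc (triple m) → bump m v ≡ suc v
bump-≤ m {v} v≤ rewrite dec-true (v ≤? suc (triple m)) v≤ = refl

bump-> : ∀ m {v} → ¬ v ≤ suc (triple m) → bump m v ≡ suc (suc v)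
bump-> m {v} v≰ rewrite dec-false (v ≤? suc (triple m)) v≰ = refl

suc≤bump : ∀ m v → suc v ≤ bump m v
suc≤bump m v with v ≤? suc (triple m)
... | yes v≤ = ≤-reflexive (sym (bump-≤ m v≤))
... | no v≰ = ≤-trans (n≤1+n (suc v)) (≤-reflexive (sym (bump-> m v≰)))

bump≤2+ : ∀ m v → bump m v ≤ suc (suc v)
bump≤2+ m v with v ≤? suc (triple m)
... | yes v≤ = ≤-trans (≤-reflexive (bump-≤ m v≤)) (n≤1+n (suc v))
... | no v≰ = ≤-reflexive (bump-> m v≰)

bump-mono-< : ∀ m {u v} → u < v → bump m u < bump m v
bump-mono-< m {u} {v} u<v with v ≤? suc (triple m)
... | yes v≤ rewrite bump-≤ m (≤-trans (<⇒≤ u<v) v≤) | bump-≤ m v≤ = s≤s u<v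
... | no v≰ = <-≤-trans (≤-<-trans (bump≤2+ m u) (s≤s (s≤s u<v))) (≤-reflexive (sym (bump-> m v≰)))

bump≢3m+3 : ∀ m v → bump m v ≢ suc (suc (suc (triple m)))
bump≢3m+3 m v with v ≤? suc (triple m)
... | yes v≤ = λ e → <⇒≢ (s≤s (s≤s v≤)) (trans (sym (bump-≤ m v≤)) e)
... | no v≰ = λ e → >⇒≢ (s≤s (s≤s (≰⇒> v≰))) (trans (sym (bump-> m v≰)) e)

bump≢3m+1 : ∀ m v → v ≢ triple m → bump m v ≢ suc (triple m)
bump≢3m+1 m v v≢3m with v ≤? suc (triple m)
... | yes v≤ rewrite bump-≤ m v≤ = v≢3m ∘′ suc-injective
... | no v≰ rewrite bump-> m v≰ = λ e → v≰ (≤-trans (n≤1+n v) (≤-trans (≤-reflexive (suc-injective e)) (n≤1+n _)))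

module Doubled {g m a b : ℕ} (adm : Admissible g m (m + m) a b) (g≢2m : g ≢ m + m) where
  open Admissible adm
  open ShapeOrder order

  2m<g : m + m < g
  2m<g = doubled adm g≢2m

  x' : ℕ
  x' = suc (suc (m + m))

  2m'<bump-a : suc m + suc m < bump m a
  2m'<bump-a = ≤-<-trans (≤-reflexive (+-suc-suc m m)) (<-≤-trans (s≤s (≤-<-trans 2m<g g<a)) (suc≤bump m a))

  x'<bump-a : x' < bump m a
  x'<bump-a = <-≤-trans (s≤s (≤-<-trans 2m<g g<a)) (suc≤bump m a)

  m'+x'≡3m+3 : suc m + x' ≡ suc (suc (suc (triple m)))
  m'+x'≡3m+3 = cong suc (trans (+-suc m _) (cong suc (+-suc m (m + m))))

  bump≢m'+x' : ∀ v → bump m v ≢ suc m + x'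
  bump≢m'+x' v e = bump≢3m+3 m v (trans e m'+x'≡3m+3)

  ≢2x' : ∀ w → w ≤ suc (suc (g + m)) → w ≢ x' + x'
  ≢2x' w w≤ = <⇒≢ (≤-<-trans w≤ (<-≤-trans (s≤s (s≤s (s≤s (≤-trans (+-monoˡ-≤ m (<⇒≤ g<m+x)) (n≤1+n _)))))
                                            (≤-reflexive (sym (2x'≡ m)))))
    where
    2x'≡ : ∀ m → suc (suc (m + m)) + suc (suc (m + m)) ≡ suc (suc (suc (suc (m + (m + m) + m))))
    2x'≡ = solve-∀

  bump≤g'+m' : ∀ v → v ≤ g + m → bump m v ≤ suc g + suc m
  bump≤g'+m' v v≤ = ≤-trans (bump≤2+ m v) (s≤s (≤-+-suc v≤))

  order' : ∀ b' → bump m a < b' → ShapeOrder (suc g) (suc m) x' (bump m a) b'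
  order' b' a'<b' = record { 0<m = s≤s z≤n ; m<x = s≤s (s≤s (m≤m+n m m)) ; x≤g = s≤s 2m<g
                           ; g<a = ≤-trans (s≤s g<a) (suc≤bump m a) ; a<b = a'<b' }

  g'<m'+x' : suc g < suc m + x'
  g'<m'+x' = subst (suc g <_) (sym m'+x'≡3m+3) (<-trans (s≤s g<m+x) (<-trans (n<1+n _) (n<1+n _)))

  admissible-unlinked : b ≤ g + m → Admissible (suc g) (suc m) x' (bump m a) (bump m b)
  admissible-unlinked b≤g+m = record
    { order = order' (bump m b) (bump-mono-< m a<b)
    ; 2m-ok = inj₁ (sym (+-suc-suc m m))
    ; g<m+x = g'<m'+x'
    ; a≢2m = >⇒≢ 2m'<bump-a
    ; b≢2m = >⇒≢ (<-trans 2m'<bump-a (bump-mono-< m a<b))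
    ; a≢m+x = bump≢m'+x' a
    ; b≢m+x = bump≢m'+x' b
    ; a≢2x = ≢2x' (bump m a) (≤-trans (bump≤2+ m a) (s≤s (s≤s a≤g+m)))
    ; b≢2x = ≢2x' (bump m b) (≤-trans (bump≤2+ m b) (s≤s (s≤s b≤g+m)))
    ; a≤g+m = bump≤g'+m' a a≤g+m
    ; b-bound = inj₁ (bump≤g'+m' b b≤g+m) }

  admissible-linked : Admissible (suc g) (suc m) x' (bump m a) (bump m a + suc m)
  admissible-linked = record
    { order = order' (bump m a + suc m) (m<m+n (bump m a) (s≤s z≤n))
    ; 2m-ok = inj₁ (sym (+-suc-suc m m))
    ; g<m+x = g'<m'+x'
    ; a≢2m = >⇒≢ 2m'<bump-a
    ; b≢2m = >⇒≢ (<-≤-trans 2m'<bump-a (m≤m+n (bump m a) (suc m)))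
    ; a≢m+x = bump≢m'+x' a
    ; b≢m+x = λ e → >⇒≢ x'<bump-a (+-cancelʳ-≡ (suc m) (bump m a) x' (trans e (+-comm (suc m) x')))
    ; a≢2x = ≢2x' (bump m a) (≤-trans (bump≤2+ m a) (s≤s (s≤s a≤g+m)))
    ; b≢2x = λ e → bump≢3m+3 m a (+-cancelʳ-≡ (suc m) (bump m a) _ (trans e (2x'≡ m)))
    ; a≤g+m = bump≤g'+m' a a≤g+m
    ; b-bound = inj₂ (refl , ≤-trans (+-monoˡ-≤ (suc m) (≤-trans (bump≤2+ m a) (s≤s (s≤s a≤g+m))))
                                     (≤-reflexive (g'+x'≡ g m))) }
    where
    2x'≡ : ∀ m → suc (suc (m + m)) + suc (suc (m + m)) ≡ suc (suc (suc (m + (m + m)))) + suc m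
    2x'≡ = solve-∀
    g'+x'≡ : ∀ g m → suc (suc (g + m)) + suc m ≡ suc g + suc (suc (m + m))
    g'+x'≡ = solve-∀

module TightLinked {m a b : ℕ} (adm : Admissible (m + m) m (m + m) a b) (a+2≤3m : suc (suc a) ≤ m + m + m) where
  open Admissible adm
  open ShapeOrder order

  m<2m : m < m + m
  m<2m = m<m+n m 0<m

  3m<a+m : triple m < a + m
  3m<a+m = subst (_< a + m) (+-comm (m + m) m) (+-monoˡ-< m g<a)

  a+m+1<4m : suc (a + m) < m + m + (m + m)
  a+m+1<4m = begin-strict
    suc (a + m)      <⟨ +-monoˡ-< m (n<1+n (suc a)) ⟩
    suc (suc a) + m  ≤⟨ +-monoˡ-≤ m a+2≤3m ⟩
    m + m + m + m    ≡⟨ +-assoc (m + m) m m ⟩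
    m + m + (m + m)  ∎
    where open ≤-Reasoning

  admissible : Admissible (suc (m + m)) (suc m) (suc (m + m)) (suc (suc a)) (suc (suc (suc (a + m))))
  admissible = record
    { order = record { 0<m = s≤s z≤n ; m<x = s≤s m<2m ; x≤g = ≤-refl
                     ; g<a = s≤s (m<n⇒m<1+n g<a) ; a<b = s≤s (s≤s (s≤s (m≤m+n a m))) }
    ; 2m-ok = inj₂ (s≤s (≤-+-suc ≤-refl))
    ; g<m+x = s≤s (≤-+-suc (m≤n+m (m + m) m))
    ; a≢2m = λ e → >⇒≢ g<a (suc-injective (trans (suc-injective e) (+-suc m m)))
    ; b≢2m = λ e → >⇒≢ (<-≤-trans g<a (≤-trans (m≤m+n a m) (n≤1+n _))) (suc-injective (trans (suc-injective e) (+-suc m m)))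
    ; a≢m+x = λ e → a≢m+x (suc-injective (trans (suc-injective e) (+-suc m (m + m))))
    ; b≢m+x = λ e → >⇒≢ (<-trans 3m<a+m (n<1+n _)) (suc-injective (trans (suc-injective e) (+-suc m (m + m))))
    ; a≢2x = λ e → <⇒≢ (≤-<-trans a≤g+m (+-monoʳ-< (m + m) m<2m)) (suc-injective (trans (suc-injective e) (+-suc (m + m) (m + m))))
    ; b≢2x = λ e → <⇒≢ a+m+1<4m (suc-injective (trans (suc-injective e) (+-suc (m + m) (m + m))))
    ; a≤g+m = s≤s (≤-trans (≤-trans (n≤1+n _) a+2≤3m) (+-monoʳ-≤ (m + m) (n≤1+n m)))
    ; b-bound = inj₂ (cong (suc ∘′ suc) (sym (+-suc a m)) ,
                      s≤s (≤-trans (s≤s (<⇒≤ a+m+1<4m)) (≤-reflexive (sym (+-suc (m + m) (m + m)))))) }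

tight-a : ∀ {m a b} → Admissible (m + m) m (m + m) a b → ¬ suc (suc a) ≤ m + m + m → suc a ≡ m + m + m
tight-a {m} {a} adm a+2≰3m = ≤-antisym a<3m (≤-pred (≰⇒> a+2≰3m))
  where
  open Admissible adm
  a<3m : a < m + m + m
  a<3m = ≤∧≢⇒< a≤g+m (λ a≡3m → a≢m+x (trans a≡3m (+-comm (m + m) m)))

≤-by-computation : ∀ {p q} {p≤q : True (p ≤? q)} → p ≤ q
≤-by-computation {p≤q = p≤q} = toWitness p≤q

≢-by-computation : ∀ {p q} {p≢q : False (p ≟ q)} → p ≢ q
≢-by-computation {p≢q = p≢q} = toWitnessFalse p≢q

-- For m ≤ 3 the generic choice of TightPulled would put a' below g'; only m ∈ {2, 3} occur.
tight-small : ∀ m a b → Admissible (m + m) m (m + m) a b → suc a ≡ m + m + m → m ≤ 3 →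
              Admissible (suc (m + m)) m (m + m) (suc (suc a)) (suc (suc (a + m)))
tight-small 0 a b adm _ _ = ⊥-elim (<-irrefl refl (ShapeOrder.0<m (Admissible.order adm)))
tight-small 1 2 b adm refl _ = ⊥-elim (<-irrefl refl (ShapeOrder.g<a (Admissible.order adm)))
tight-small 2 5 b adm refl _ = record
    { order = record { 0<m = ≤-by-computation ; m<x = ≤-by-computation ; x≤g = ≤-by-computation
                     ; g<a = ≤-by-computation ; a<b = ≤-by-computation }
    ; 2m-ok = inj₁ refl ; g<m+x = ≤-by-computation
    ; a≢2m = ≢-by-computation ; b≢2m = ≢-by-computation ; a≢m+x = ≢-by-computation
    ; b≢m+x = ≢-by-computation ; a≢2x = ≢-by-computation ; b≢2x = ≢-by-computation
    ; a≤g+m = ≤-by-computation ; b-bound = inj₂ (refl , ≤-by-computation) }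
tight-small 3 8 b adm refl _ = record
    { order = record { 0<m = ≤-by-computation ; m<x = ≤-by-computation ; x≤g = ≤-by-computation
                     ; g<a = ≤-by-computation ; a<b = ≤-by-computation }
    ; 2m-ok = inj₁ refl ; g<m+x = ≤-by-computation
    ; a≢2m = ≢-by-computation ; b≢2m = ≢-by-computation ; a≢m+x = ≢-by-computation
    ; b≢m+x = ≢-by-computation ; a≢2x = ≢-by-computation ; b≢2x = ≢-by-computation
    ; a≤g+m = ≤-by-computation ; b-bound = inj₂ (refl , ≤-by-computation) }
tight-small (suc (suc (suc (suc m)))) a b adm _ (s≤s (s≤s (s≤s ())))

module TightPulled {m p : ℕ} (p+2≡3m : suc (suc p) ≡ m + m + m) (3<m : 3 < m) where
  p<3m : p < m + m + m
  p<3m = subst (p <_) p+2≡3m (≤-trans (n<1+n p) (n≤1+n _))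

  0<m : 0 < m
  0<m = <-trans (s≤s z≤n) 3<m

  m<2m : m < m + m
  m<2m = m<m+n m 0<m

  2m+1<p : suc (m + m) < p
  2m+1<p = ≤-pred (≤-pred (begin
    suc (suc (suc (suc (m + m)))) ≡⟨ +-comm 4 (m + m) ⟩
    m + m + 4                     ≤⟨ +-monoʳ-≤ (m + m) 3<m ⟩
    m + m + m                     ≡⟨ sym p+2≡3m ⟩
    suc (suc p)                   ∎))
    where open ≤-Reasoning

  2m+1<3m : suc (m + m) < triple m
  2m+1<3m = begin-strict
    suc (m + m)  <⟨ n<1+n _ ⟩
    2 + (m + m)  ≡⟨ +-comm 2 (m + m) ⟩
    m + m + 2    <⟨ +-monoʳ-< (m + m) (<-trans (n<1+n 2) 3<m) ⟩
    m + m + m    ≡⟨ +-comm (m + m) m ⟩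
    triple m     ∎
    where open ≤-Reasoning

  2m<p : m + m < p
  2m<p = <-trans (n<1+n _) 2m+1<p

  admissible : Admissible (suc (m + m)) m (m + m) p (p + m)
  admissible = record
    { order = record { 0<m = 0<m ; m<x = m<2m ; x≤g = n≤1+n _ ; g<a = 2m+1<p ; a<b = m<m+n p 0<m }
    ; 2m-ok = inj₁ refl
    ; g<m+x = 2m+1<3m
    ; a≢2m = >⇒≢ 2m<p
    ; b≢2m = >⇒≢ (<-≤-trans 2m<p (m≤m+n p m))
    ; a≢m+x = <⇒≢ (<-≤-trans p<3m (≤-reflexive (+-comm (m + m) m)))
    ; b≢m+x = λ e → >⇒≢ 2m<p (+-cancelʳ-≡ m p (m + m) (trans e (+-comm m (m + m))))
    ; a≢2x = <⇒≢ (<-trans p<3m (+-monoʳ-< (m + m) m<2m))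
    ; b≢2x = λ e → <⇒≢ p<3m (+-cancelʳ-≡ m p (m + m + m) (trans e (sym (+-assoc (m + m) m m))))
    ; a≤g+m = ≤-trans (<⇒≤ p<3m) (+-monoˡ-≤ m (n≤1+n _))
    ; b-bound = inj₂ (refl , ≤-trans (<⇒≤ (+-monoˡ-< m p<3m)) (≤-trans (≤-reflexive (+-assoc (m + m) m m)) (n≤1+n _))) }

lift-high : ℕ → ℕ → ℕ → ℕ → ℕ → Tuple
lift-high g m x a b with b ≤? g + m
... | yes _ = tuple (suc m) (suc x) (suc (suc a)) (suc (suc b))
... | no _ with a ≟ suc (m + m)
...   | no _ = tuple (suc m) (suc x) (suc a) (suc (suc (a + m)))
...   | yes _ with x + x ≟ m + m + m
...     | yes _ = tuple (suc m) (suc x) (suc (suc g)) (suc (suc (g + m)))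
...     | no _ = tuple (suc m) (suc x) a (suc (a + m))

lift-doubled : ℕ → ℕ → ℕ → ℕ → Tuple
lift-doubled g m a b with b ≤? g + m
... | yes _ = tuple (suc m) (suc (suc (m + m))) (bump m a) (bump m b)
... | no _ = tuple (suc m) (suc (suc (m + m))) (bump m a) (bump m a + suc m)

lift-tight : ℕ → ℕ → ℕ → Tuple
lift-tight m a b with b ≤? (m + m) + m
... | yes _ = tuple (suc m) (suc (m + m)) (suc (suc a)) (suc (suc b))
... | no _ with suc (suc a) ≤? (m + m) + m
...   | yes _ = tuple (suc m) (suc (m + m)) (suc (suc a)) (suc (suc (suc (a + m))))
...   | no _ with m ≤? 3
...     | yes _ = tuple m (m + m) (suc (suc a)) (suc (suc (a + m)))
...     | no _ = tuple m (m + m) (pred a) (pred a + m)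

lift : ℕ → Tuple → Tuple
lift g (tuple m x a b) with x ≟ m + m | g ≟ m + m
... | no _ | _ = lift-high g m x a b
... | yes _ | no _ = lift-doubled g m a b
... | yes _ | yes _ = lift-tight m a b

lift-high-admissible : ∀ {g m x a b} → Admissible g m x a b → x ≢ m + m → Admissibleᵗ (suc g) (lift-high g m x a b)
lift-high-admissible {g} {m} {x} {a} {b} adm x≢2m with b ≤? g + m
... | yes b≤g+m = ShiftGaps.admissible adm (<⇒≤ (high adm x≢2m)) b≤g+m
... | no b≰g+m with a ≟ suc (m + m)
...   | no a≢2m+1 = HighLinked.admissible adm x≢2m b≰g+m a≢2m+1
...   | yes refl with x + x ≟ m + m + m
...     | yes 2x≡3m = HighLinked.admissible-jump adm x≢2m b≰g+m refl 2x≡3m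
...     | no 2x≢3m = HighLinked.admissible-keep adm x≢2m b≰g+m refl 2x≢3m

lift-doubled-admissible : ∀ {g m a b} → Admissible g m (m + m) a b → g ≢ m + m → Admissibleᵗ (suc g) (lift-doubled g m a b)
lift-doubled-admissible {g} {m} {a} {b} adm g≢2m with b ≤? g + m
... | yes b≤g+m = Doubled.admissible-unlinked adm g≢2m b≤g+m
... | no _ = Doubled.admissible-linked adm g≢2m

lift-tight-admissible : ∀ {m a b} → Admissible (m + m) m (m + m) a b → Admissibleᵗ (suc (m + m)) (lift-tight m a b)
lift-tight-admissible {m} {a} {b} adm with b ≤? (m + m) + m
... | yes b≤g+m = ShiftGaps.admissible adm ≤-refl b≤g+m
... | no b≰g+m with suc (suc a) ≤? (m + m) + m
...   | yes a+2≤3m = TightLinked.admissible adm a+2≤3m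
...   | no a+2≰3m with m ≤? 3
...     | yes m≤3 = tight-small m a b adm (tight-a adm a+2≰3m) m≤3
...     | no m≰3 with a
...       | zero = ⊥-elim (n≮0 (ShapeOrder.g<a (Admissible.order adm)))
...       | suc _ = TightPulled.admissible (tight-a adm a+2≰3m) (≰⇒> m≰3)

lift-admissible : ∀ g t → Admissibleᵗ g t → Admissibleᵗ (suc g) (lift g t)
lift-admissible g (tuple m x a b) adm with x ≟ m + m | g ≟ m + m
... | no x≢2m | _ = lift-high-admissible adm x≢2m
... | yes refl | no g≢2m = lift-doubled-admissible adm g≢2m
... | yes refl | yes refl = lift-tight-admissible adm

unbump : ℕ → ℕ → ℕ
unbump m w = if does (w ≤? suc (suc (triple m))) then pred w else pred (pred w)

unbump-bump : ∀ m v → unbump m (bump m v) ≡ v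
unbump-bump m v with v ≤? suc (triple m)
... | yes v≤ rewrite bump-≤ m v≤ | dec-true (suc v ≤? suc (suc (triple m))) (s≤s v≤) = refl
... | no v≰ rewrite bump-> m v≰ | dec-false (suc (suc v) ≤? suc (suc (triple m))) (v≰ ∘′ ≤-trans (n≤1+n v) ∘′ ≤-pred) = refl

lower-high : ℕ → ℕ → ℕ → ℕ → ℕ → Tuple
lower-high g m' x' a' b' =
  if does (b' ≟ a' + m')
  then (if does (a' ≟ suc (m + m)) then tuple m x a' (a' + m) else tuple m x (pred a') (pred a' + m))
  else (if does (a' ≟ suc (suc g)) then tuple m x (suc (m + m)) (suc (m + m) + m) else tuple m x (pred (pred a')) (pred (pred b')))
  where
  m x : ℕ
  m = pred m'
  x = pred x'

lower-doubled : ℕ → ℕ → ℕ → ℕ → Tuple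
lower-doubled m' x' a' b' =
  tuple m (pred (pred x')) a (if does (b' ≟ a' + m') then a + m else unbump m b')
  where
  m a : ℕ
  m = pred m'
  a = unbump m a'

lower-tight : ℕ → ℕ → ℕ → ℕ → Tuple
lower-tight m' x' a' b' =
  tuple (pred m') (pred x') (pred (pred a')) (if does (b' ≟ a' + m') then pred (pred a') + pred m' else pred (pred b'))

lower-pulled : ℕ → ℕ → Tuple
lower-pulled m' x' = tuple m' x' (pred (m' + m' + m')) (pred (m' + m' + m') + m')

-- A left inverse of lift g on admissible tuples: the regime is read off by comparing 2m'
-- with g' = g + 1, and within a regime the branch by whether b' = a' + m'.
lower : ℕ → Tuple → Tuple
lower g (tuple m' x' a' b') with m' + m' ≤? suc g
lower g (tuple m' x' a' b') | yes _ with m' + m' ≟ g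
lower g (tuple m' x' a' b') | yes _ | yes _ with m' ≤? 3
... | yes _ = lower-pulled m' x'
... | no _ with a' ≟ pred (pred (m' + m' + m'))
...   | yes _ = lower-pulled m' x'
...   | no _ = lower-doubled m' x' a' b'
lower g (tuple m' x' a' b') | yes _ | no _ = lower-doubled m' x' a' b'
lower g (tuple m' x' a' b') | no _ with m' + m' ≟ suc (suc g)
... | yes _ = lower-tight m' x' a' b'
... | no _ = lower-high g m' x' a' b'

lower-high-unlinked : ∀ g m' x' a' b' → b' ≢ a' + m' → a' ≢ suc (suc g) →
                      lower-high g m' x' a' b' ≡ tuple (pred m') (pred x') (pred (pred a')) (pred (pred b'))
lower-high-unlinked g m' x' a' b' unlinked a'≢ rewrite dec-false (b' ≟ a' + m') unlinked | dec-false (a' ≟ suc (suc g)) a'≢ = refl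

lower-high-jump : ∀ g m' x' a' b' → b' ≢ a' + m' → a' ≡ suc (suc g) →
                  lower-high g m' x' a' b' ≡ tuple (pred m') (pred x') (suc (pred m' + pred m')) (suc (pred m' + pred m') + pred m')
lower-high-jump g m' x' a' b' unlinked a'≡ rewrite dec-false (b' ≟ a' + m') unlinked | dec-true (a' ≟ suc (suc g)) a'≡ = refl

lower-high-linked : ∀ g m' x' a' b' → b' ≡ a' + m' → a' ≢ suc (pred m' + pred m') →
                    lower-high g m' x' a' b' ≡ tuple (pred m') (pred x') (pred a') (pred a' + pred m')
lower-high-linked g m' x' a' b' b'-linked a'≢ rewrite dec-true (b' ≟ a' + m') b'-linked | dec-false (a' ≟ suc (pred m' + pred m')) a'≢ = refl

lower-high-keep : ∀ g m' x' a' b' → b' ≡ a' + m' → a' ≡ suc (pred m' + pred m') →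
                  lower-high g m' x' a' b' ≡ tuple (pred m') (pred x') a' (a' + pred m')
lower-high-keep g m' x' a' b' b'-linked a'≡ rewrite dec-true (b' ≟ a' + m') b'-linked | dec-true (a' ≟ suc (pred m' + pred m')) a'≡ = refl

lower-doubled-unlinked : ∀ m' x' a' b' → b' ≢ a' + m' →
                         lower-doubled m' x' a' b' ≡ tuple (pred m') (pred (pred x')) (unbump (pred m') a') (unbump (pred m') b')
lower-doubled-unlinked m' x' a' b' unlinked rewrite dec-false (b' ≟ a' + m') unlinked = refl

lower-doubled-linked : ∀ m' x' a' b' → b' ≡ a' + m' →
                       lower-doubled m' x' a' b' ≡ tuple (pred m') (pred (pred x')) (unbump (pred m') a') (unbump (pred m') a' + pred m')
lower-doubled-linked m' x' a' b' b'-linked rewrite dec-true (b' ≟ a' + m') b'-linked = refl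

lower-tight-unlinked : ∀ m' x' a' b' → b' ≢ a' + m' →
                       lower-tight m' x' a' b' ≡ tuple (pred m') (pred x') (pred (pred a')) (pred (pred b'))
lower-tight-unlinked m' x' a' b' unlinked rewrite dec-false (b' ≟ a' + m') unlinked = refl

lower-tight-linked : ∀ m' x' a' b' → b' ≡ a' + m' →
                     lower-tight m' x' a' b' ≡ tuple (pred m') (pred x') (pred (pred a')) (pred (pred a') + pred m')
lower-tight-linked m' x' a' b' b'-linked rewrite dec-true (b' ≟ a' + m') b'-linked = refl

lower-of-high : ∀ {g m} x' a' b' → g < m + m → lower g (tuple (suc m) x' a' b') ≡ lower-high g (suc m) x' a' b'
lower-of-high {g} {m} x' a' b' g<2m with suc m + suc m ≤? suc g
... | yes 2m'≤g' = ⊥-elim (<⇒≱ g<2m (≤-pred (≤-pred (≤-trans (≤-reflexive (sym (+-suc-suc m m))) (m≤n⇒m≤1+n 2m'≤g')))))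
... | no _ with suc m + suc m ≟ suc (suc g)
...   | yes 2m'≡g'+1 = ⊥-elim (<⇒≢ g<2m (sym (suc-injective (suc-injective (trans (sym (+-suc-suc m m)) 2m'≡g'+1)))))
...   | no _ = refl

lower-of-tight : ∀ m x' a' b' → lower (m + m) (tuple (suc m) x' a' b') ≡ lower-tight (suc m) x' a' b'
lower-of-tight m x' a' b' with suc m + suc m ≤? suc (m + m)
... | yes 2m'≤g' = ⊥-elim (<-irrefl refl (≤-trans (≤-reflexive (sym (+-suc-suc m m))) 2m'≤g'))
... | no _ with suc m + suc m ≟ suc (suc (m + m))
...   | yes _ = refl
...   | no 2m'≢g'+1 = ⊥-elim (2m'≢g'+1 (+-suc-suc m m))

lower-of-pulled : ∀ m x' a' b' → m ≤ 3 ⊎ a' ≡ pred (pred (m + m + m)) →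
                  lower (m + m) (tuple m x' a' b') ≡ lower-pulled m x'
lower-of-pulled m x' a' b' small-or-pulled with m + m ≤? suc (m + m)
... | no 2m≰g' = ⊥-elim (2m≰g' (n≤1+n _))
... | yes _ with m + m ≟ m + m
...   | no 2m≢g = ⊥-elim (2m≢g refl)
...   | yes _ with m ≤? 3 | small-or-pulled
...     | yes _ | _ = refl
...     | no m≰3 | inj₁ m≤3 = ⊥-elim (m≰3 m≤3)
...     | no _ | inj₂ a'≡ with a' ≟ pred (pred (m + m + m))
...       | yes _ = refl
...       | no a'≢ = ⊥-elim (a'≢ a'≡)

lower-of-doubled : ∀ {g m a} x' b' → m + m < g → g < triple m → a ≢ triple m →
                   lower g (tuple (suc m) x' (bump m a) b') ≡ lower-doubled (suc m) x' (bump m a) b'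
lower-of-doubled {g} {m} {a} x' b' 2m<g g<3m a≢3m with suc m + suc m ≤? suc g
... | no 2m'≰g' = ⊥-elim (2m'≰g' (≤-trans (≤-reflexive (+-suc-suc m m)) (s≤s 2m<g)))
... | yes _ with suc m + suc m ≟ g
...   | no _ = refl
...   | yes 2m'≡g with suc m ≤? 3
...     | yes m'≤3 = ⊥-elim (<⇒≱ g<3m (begin
          m + (m + m)    ≡⟨ +-comm m (m + m) ⟩
          m + m + m      ≤⟨ +-monoʳ-≤ (m + m) (≤-pred m'≤3) ⟩
          m + m + 2      ≡⟨ +-comm (m + m) 2 ⟩
          suc (suc (m + m)) ≡⟨ sym (+-suc-suc m m) ⟩
          suc m + suc m  ≡⟨ 2m'≡g ⟩
          g              ∎))
      where open ≤-Reasoning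
...     | no _ with bump m a ≟ pred (pred (suc m + suc m + suc m))
...       | yes bump-a≡ = ⊥-elim (bump≢3m+1 m a a≢3m (trans bump-a≡ (cong (pred ∘′ pred) (3m'≡ m))))
      where
      3m'≡ : ∀ m → suc m + suc m + suc m ≡ suc (suc (suc (m + (m + m))))
      3m'≡ = solve-∀
...       | no _ = refl

shifted-unlinked : ∀ {g m a b} → b ≤ g + m → g < a → suc (suc b) ≢ suc (suc a) + suc m
shifted-unlinked {g} {m} {a} b≤g+m g<a e =
  <⇒≢ (≤-<-trans b≤g+m (<-≤-trans (+-monoˡ-< m g<a) (+-monoʳ-≤ a (n≤1+n m)))) (suc-injective (suc-injective e))

lower-lift-high : ∀ {g m x a b} → Admissible g m x a b → x ≢ m + m → lower g (lift-high g m x a b) ≡ tuple m x a b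
lower-lift-high {g} {m} {x} {a} {b} adm x≢2m with b ≤? g + m
... | yes b≤g+m =
  trans (lower-of-high (suc x) (suc (suc a)) (suc (suc b)) (high adm x≢2m))
        (lower-high-unlinked g (suc m) (suc x) (suc (suc a)) (suc (suc b))
          (shifted-unlinked b≤g+m g<a) (>⇒≢ g<a ∘′ suc-injective ∘′ suc-injective))
  where open ShapeOrder (Admissible.order adm)
... | no b≰g+m with a ≟ suc (m + m)
...   | no a≢2m+1 =
  trans (lower-of-high (suc x) (suc a) (suc (suc (a + m))) (high adm x≢2m))
        (trans (lower-high-linked g (suc m) (suc x) (suc a) (suc (suc (a + m)))
                 (cong suc (sym (+-suc a m))) (Admissible.a≢2m adm ∘′ suc-injective))
               (cong (tuple m x a) (sym (proj₁ (linked adm b≰g+m)))))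
...   | yes refl with x + x ≟ m + m + m
...     | yes _ =
  trans (lower-of-high (suc x) (suc (suc g)) (suc (suc (g + m))) (high adm x≢2m))
        (trans (lower-high-jump g (suc m) (suc x) (suc (suc g)) (suc (suc (g + m))) jump-unlinked refl)
               (cong (tuple m x (suc (m + m))) (sym (proj₁ (linked adm b≰g+m)))))
  where
  jump-unlinked : suc (suc (g + m)) ≢ suc (suc g) + suc m
  jump-unlinked e = <⇒≢ (n<1+n m) (+-cancelˡ-≡ g m (suc m) (suc-injective (suc-injective e)))
...     | no _ =
  trans (lower-of-high (suc x) (suc (m + m)) (suc (suc (m + m) + m)) (high adm x≢2m))
        (trans (lower-high-keep g (suc m) (suc x) (suc (m + m)) (suc (suc (m + m) + m)) (sym (+-suc (suc (m + m)) m)) refl)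
               (cong (tuple m x (suc (m + m))) (sym (proj₁ (linked adm b≰g+m)))))

lower-lift-doubled : ∀ {g m a b} → Admissible g m (m + m) a b → g ≢ m + m →
                     lower g (lift-doubled g m a b) ≡ tuple m (m + m) a b
lower-lift-doubled {g} {m} {a} {b} adm g≢2m with b ≤? g + m
... | yes b≤g+m =
  trans (lower-of-doubled _ (bump m b) (doubled adm g≢2m) g<m+x a≢m+x)
        (trans (lower-doubled-unlinked (suc m) (suc (suc (m + m))) (bump m a) (bump m b) unlinked)
               (cong₂ (tuple m (m + m)) (unbump-bump m a) (unbump-bump m b)))
  where
  open Admissible adm
  open ShapeOrder order
  unlinked : bump m b ≢ bump m a + suc m
  unlinked = <⇒≢ (begin-strict
    bump m b          ≤⟨ bump≤2+ m b ⟩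
    suc (suc b)       ≤⟨ s≤s (s≤s b≤g+m) ⟩
    suc (suc (g + m)) <⟨ s≤s (s≤s (+-monoˡ-< m g<a)) ⟩
    suc (suc (a + m)) ≡⟨ cong suc (sym (+-suc a m)) ⟩
    suc a + suc m     ≤⟨ +-monoˡ-≤ (suc m) (suc≤bump m a) ⟩
    bump m a + suc m  ∎)
    where open ≤-Reasoning
... | no b≰g+m =
  trans (lower-of-doubled _ (bump m a + suc m) (doubled adm g≢2m) g<m+x a≢m+x)
        (trans (lower-doubled-linked (suc m) (suc (suc (m + m))) (bump m a) (bump m a + suc m) refl)
               (cong₂ (tuple m (m + m)) (unbump-bump m a)
                      (trans (cong (_+ m) (unbump-bump m a)) (sym (proj₁ (linked adm b≰g+m))))))
  where open Admissible adm

pulled-tuple : ∀ {m a b} → suc a ≡ m + m + m → b ≡ a + m →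
               tuple m (m + m) (pred (m + m + m)) (pred (m + m + m) + m) ≡ tuple m (m + m) a b
pulled-tuple {m} {a} a+1≡3m b≡a+m = tuple-≡ refl refl 3m-1≡a (trans (cong (_+ m) 3m-1≡a) (sym b≡a+m))
  where
  3m-1≡a : pred (m + m + m) ≡ a
  3m-1≡a = cong pred (sym a+1≡3m)

lower-lift-tight : ∀ {m a b} → Admissible (m + m) m (m + m) a b → lower (m + m) (lift-tight m a b) ≡ tuple m (m + m) a b
lower-lift-tight {m} {a} {b} adm with b ≤? (m + m) + m
... | yes b≤g+m =
  trans (lower-of-tight m _ _ (suc (suc b)))
        (lower-tight-unlinked (suc m) (suc (m + m)) (suc (suc a)) (suc (suc b))
          (shifted-unlinked b≤g+m (ShapeOrder.g<a (Admissible.order adm))))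
... | no b≰g+m with suc (suc a) ≤? (m + m) + m
...   | yes _ =
  trans (lower-of-tight m _ _ (suc (suc (suc (a + m)))))
        (trans (lower-tight-linked (suc m) (suc (m + m)) (suc (suc a)) (suc (suc (suc (a + m))))
                 (cong (suc ∘′ suc) (sym (+-suc a m))))
               (cong (tuple m (m + m) a) (sym (proj₁ (linked adm b≰g+m)))))
...   | no a+2≰3m with m ≤? 3
...     | yes m≤3 =
  trans (lower-of-pulled m (m + m) (suc (suc a)) _ (inj₁ m≤3))
        (pulled-tuple (tight-a adm a+2≰3m) (proj₁ (linked adm b≰g+m)))
...     | no _ with a
...       | zero = ⊥-elim (n≮0 (ShapeOrder.g<a (Admissible.order adm)))
...       | suc p =
  trans (lower-of-pulled m (m + m) p _ (inj₂ (cong (pred ∘′ pred) (tight-a adm a+2≰3m))))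
        (pulled-tuple (tight-a adm a+2≰3m) (proj₁ (linked adm b≰g+m)))

lower-lift : ∀ g t → Admissibleᵗ g t → lower g (lift g t) ≡ t
lower-lift g (tuple m x a b) adm with x ≟ m + m | g ≟ m + m
... | no x≢2m | _ = lower-lift-high adm x≢2m
... | yes refl | no g≢2m = lower-lift-doubled adm g≢2m
... | yes refl | yes refl = lower-lift-tight adm

lift-injective : ∀ g t t' → Admissibleᵗ g t → Admissibleᵗ g t' → lift g t ≡ lift g t' → t ≡ t'
lift-injective g t t' adm adm' lift≡ = begin
  t                   ≡⟨ sym (lower-lift g t adm) ⟩
  lower g (lift g t)  ≡⟨ cong (lower g) lift≡ ⟩
  lower g (lift g t') ≡⟨ lower-lift g t' adm' ⟩
  t'                  ∎
  where open ≡-Reasoning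

liftNS2 : ∀ g S → NS2 g S → Subsetℕ
liftNS2 g S ns2 = shapeᵗ (suc g) (lift g (ShapeOf.parameters (decompose g S ns2)))

liftNS2-ns2 : ∀ g S ns2 → NS2 (suc g) (liftNS2 g S ns2)
liftNS2-ns2 g S ns2 = ns2-shapeᵗ (suc g) (lift g parameters) (lift-admissible g parameters admissible)
  where open ShapeOf (decompose g S ns2)

liftNS2-reflects : ∀ g S S' ns2 ns2' → liftNS2 g S ns2 ≈ liftNS2 g S' ns2' → S ≈ S'
liftNS2-reflects g S S' ns2 ns2' lifted≈ =
  ≈-trans D.≈shape (≈-trans (λ n → cong (λ t → shapeᵗ g t n) t≡t') (≈-sym D'.≈shape))
  where
  module D = ShapeOf (decompose g S ns2)
  module D' = ShapeOf (decompose g S' ns2')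
  t≡t' : D.parameters ≡ D'.parameters
  t≡t' = lift-injective g _ _ D.admissible D'.admissible
           (shapeᵗ-injective (suc g) _ _ (lift-admissible g _ D.admissible) (lift-admissible g _ D'.admissible) lifted≈)

mainTheorem2 : ∀ (g : ℕ) → 1 ≤ g → ∀ (a b : ℕ) →
    HasCount (NS2 g) a → HasCount (NS2 (suc g)) b → a ≤ b
mainTheorem2 g _ a b = HasCount-≤ (liftNS2 g) (liftNS2-ns2 g) (liftNS2-reflects g)
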